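{- Let $\mathcal{Q}$ be a finite poset. Then the space of relations $\mathfrak{R}^{\bar\star}_\mathcal{Q}$ of $\mathsf{As}(\mathcal{Q})^!$ satisfies $\dim\mathfrak{R}^{\bar\star}_\mathcal{Q}=2(\#\mathcal{Q})^2+3\,\#\mathcal{Q}-4\,\mathrm{int}(\mathcal{Q})$.
   Context: Operads are nonsymmetric over a field of characteristic zero. For comparable $a,b$, $a\uparrow_\mathcal{Q} b:=\min(a,b)$. $\mathsf{As}(\mathcal{Q})$ has presentation with binary generators $\star_a$, $a\in\mathcal{Q}$, and space of relations $\mathfrak{R}$ spanned by $\star_a\circ_1\star_b-\star_{a\uparrow b}\circ_2\star_{a\uparrow b}$ and $\star_{a\uparrow b}\circ_1\star_{a\uparrow b}-\star_a\circ_2\star_b$ for comparable $a,b$ (including $a=b$). Its Koszul dual $\mathsf{As}(\mathcal{Q})^!$ has binary generators $\bar\star_a$ and space of relations $\mathfrak{R}^{\bar\star}_\mathcal{Q}=\mathfrak{R}^\perp$, the annihilator of $\mathfrak{R}$ in the arity-$3$ part of the free operad for the bilinear form with $\langle x\circ_i y,x'\circ_{i'}y'\rangle=1$ if $x=x',y=y',i=i'=1$, $=-1$ if $x=x',y=y',i=i'=2$, $0$ otherwise. $\mathrm{int}(\mathcal{Q})$ is the number of pairs $(a,c)$ with $a\preccurlyeq_\mathcal{Q} c$. -}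

module Defs where

open import Level using (Level; _⊔_)
open import Algebra.Bundles using (CommutativeRing)
open import Data.Nat as ℕ using (ℕ; zero; suc)
open import Data.Fin using (Fin; zero; suc; _≟_)
open import Data.Fin.Properties using (all?)
open import Data.List using (List; filter; length)
open import Data.List using () renaming (allFin to allFinL)
open import Data.Product using (Σ; ∃; _×_; _,_)
open import Data.Sum using (_⊎_)
open import Relation.Nullary using (¬_; Dec; yes; no; does)
open import Relation.Binary.Core using (Rel)
open import Relation.Binary.PropositionalEquality using (_≡_)
open import Relation.Binary.Structures using (IsDecPartialOrder)
open import Data.Bool using (Bool; true; false; _∧_; if_then_else_)

record Field (c ℓ : Level) : Set (Level.suc (c ⊔ ℓ)) where
  field
    commutativeRing : CommutativeRing c ℓ
  open CommutativeRing commutativeRing public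
  field
    0≉1     : ¬ (0# ≈ 1#)
    inverse : ∀ x → ¬ (x ≈ 0#) → Σ Carrier λ y → (x * y) ≈ 1#

module FieldOps {c ℓ} (K : Field c ℓ) where
  open Field K using (Carrier; 0#; 1#; _+_)

  natCast : ℕ → Carrier
  natCast zero    = 0#
  natCast (suc n) = 1# + natCast n

  sumFin : (m : ℕ) → (Fin m → Carrier) → Carrier
  sumFin zero    f = 0#
  sumFin (suc m) f = f zero + sumFin m (λ i → f (suc i))

CharZero : ∀ {c ℓ} → Field c ℓ → Set ℓ
CharZero K = ∀ n → ¬ (natCast (suc n) ≈ 0#)
  where open Field K using (_≈_; 0#)
        open FieldOps K

record FinPoset (n : ℕ) : Set₁ where
  field
    _≼_   : Rel (Fin n) Level.zero
    isDPO : IsDecPartialOrder _≡_ _≼_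
  open IsDecPartialOrder isDPO public using (_≤?_)

  Comparable : Fin n → Fin n → Set
  Comparable a b = (a ≼ b) ⊎ (b ≼ a)

  -- a ↑ b := min(a,b) (meaningful for comparable a, b)
  _↑_ : Fin n → Fin n → Fin n
  a ↑ b = if does (a ≤? b) then a else b

  int : ℕ
  int = length (filter (λ p → Data.Product.proj₁ p ≤? Data.Product.proj₂ p)
                       (Data.List.cartesianProduct (allFinL n) (allFinL n)))

-- The arity-3 part of the free operad on generators ⋆_a (a ∈ Q):
-- basis  x ∘_i y  with x, y ∈ Q, i ∈ {1,2} (i = zero ↔ ∘₁, i = suc zero ↔ ∘₂).

module Arity3 {c ℓ} (K : Field c ℓ) {n : ℕ} (Q : FinPoset n) where
  open Field K using (Carrier; _≈_; 0#; 1#; _*_; _-_; -_)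
  open FieldOps K
  open FinPoset Q

  V : Set c
  V = Fin n → Fin n → Fin 2 → Carrier

  _≈V_ : V → V → Set ℓ
  u ≈V v = ∀ x y i → u x y i ≈ v x y i

  0V : V
  0V _ _ _ = 0#

  e : Fin n → Fin n → Fin 2 → V
  e x y i x' y' i' =
    if does (x ≟ x') ∧ does (y ≟ y') ∧ does (i ≟ i') then 1# else 0#

  _-V_ : V → V → V
  (u -V v) x y i = u x y i - v x y i

  sgn : Fin 2 → Carrier
  sgn zero    = 1#
  sgn (suc _) = - 1#

  ⟨_,_⟩ : V → V → Carrier
  ⟨ u , v ⟩ = sumFin n λ x → sumFin n λ y → sumFin 2 λ i →
                sgn i * (u x y i * v x y i)

  -- generators of 𝔑, for comparable a, b:
  --   ⋆_a ∘₁ ⋆_b − ⋆_{a↑b} ∘₂ ⋆_{a↑b}   and   ⋆_{a↑b} ∘₁ ⋆_{a↑b} − ⋆_a ∘₂ ⋆_b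
  rel₁ rel₂ : Fin n → Fin n → V
  rel₁ a b = e a b zero -V e (a ↑ b) (a ↑ b) (suc zero)
  rel₂ a b = e (a ↑ b) (a ↑ b) zero -V e a b (suc zero)

  -- 𝔑 = span of the rel's;  𝔑^⊥ = annihilator of 𝔑 (equivalently of its
  -- spanning family, the form being bilinear).
  InAnnihilator : V → Set ℓ
  InAnnihilator w = ∀ a b → Comparable a b →
    (⟨ w , rel₁ a b ⟩ ≈ 0#) × (⟨ w , rel₂ a b ⟩ ≈ 0#)

  lincomb : (d : ℕ) → (Fin d → Carrier) → (Fin d → V) → V
  lincomb d coef b x y i = sumFin d λ j → coef j * b j x y i

  HasDim : (V → Set ℓ) → ℕ → Set (c ⊔ ℓ)
  HasDim S d = Σ (Fin d → V) λ b →
      (∀ j → S (b j))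
    × (∀ coef → lincomb d coef b ≈V 0V → ∀ j → coef j ≈ 0#)
    × (∀ w → S w → Σ (Fin d → Carrier) λ coef → w ≈V lincomb d coef b)

-- Pairing w with the two relations of a comparable pair (a, b), m = a ↑ b, gives
-- w(a ∘₁ b) + w(m ∘₂ m) and w(m ∘₁ m) + w(a ∘₂ b).  Hence w lies in the annihilator iff
-- w(a ∘₁ b) = w(m ∘₁ m) and w(a ∘₂ b) = − w(m ∘₁ m) for every comparable pair: the annihilator
-- is the image of the projection ext that recomputes these coordinates from the free ones,
-- namely m ∘₁ m for m ∈ Q and both coordinates of each incomparable ordered pair.  The images of
-- the free basis vectors form a basis, so the dimension is #Q + 2k with k the number of
-- incomparable ordered pairs; since k + #{comparable ordered pairs} = (#Q)² and
-- #{comparable ordered pairs} + #Q = 2 int(Q), this is 2(#Q)² + 3#Q − 4 int(Q).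

module Submission where

open import Defs
open import Algebra.Bundles using (Monoid)
open import Data.Nat using (ℕ; zero; suc)
open import Data.Fin using (Fin; zero; suc; _≟_)
open import Data.Fin.Properties using (suc-injective)
open import Data.Vec.Functional using (Vector)
open import Data.Product using (Σ; ∃; _×_; _,_; proj₁; proj₂)
open import Data.Sum using (_⊎_; inj₁; inj₂)
open import Data.Empty using (⊥-elim)
open import Data.List using (List; []; _∷_; _++_; map; filter; length; lookup; tabulate; cartesianProduct; allFin)
open import Data.List.Properties using (map-++; map-∘)
open import Data.List.Membership.Propositional using (_∈_)
open import Data.List.Membership.Propositional.Properties
  using (∈-lookup; ∈-filter⁺; ∈-filter⁻; ∈-cartesianProduct⁺; ∈-allFin)
open import Data.List.Relation.Unary.Any using (index)
open import Data.List.Relation.Unary.Any.Properties using (lookup-index)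
open import Data.List.Relation.Unary.All as All using ()
open import Data.List.Relation.Unary.AllPairs using (_∷_)
open import Data.List.Relation.Unary.Unique.Propositional using (Unique)
import Data.List.Relation.Unary.Unique.Propositional.Properties as Unique
open import Relation.Nullary using (¬_; Dec; yes; no)
open import Relation.Nullary.Decidable using (¬?; _⊎-dec_; _×-dec_; dec-true)
open import Relation.Unary using (Pred; Decidable)
open import Relation.Binary.PropositionalEquality as ≡ using (_≡_; _≢_; refl; module ≡-Reasoning)
open import Relation.Binary.Structures using (IsDecPartialOrder)
open import Function using (_∘_; id)

module MonoidSum {a ℓ} (M : Monoid a ℓ) where
  open Monoid M
  open import Algebra.Properties.Monoid.Sum M using (sum; sum-cong-≋; sum-replicate-zero)

  sum-zero : ∀ {m} (f : Vector Carrier m) → (∀ i → f i ≈ ε) → sum f ≈ ε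
  sum-zero {m} f f≈ε = trans (sum-cong-≋ f≈ε) (sum-replicate-zero m)

  sum-supported : ∀ {m} (f : Vector Carrier m) j → (∀ i → i ≢ j → f i ≈ ε) → sum f ≈ f j
  sum-supported f zero    f≈ε =
    trans (∙-congˡ (sum-zero (f ∘ suc) λ i → f≈ε (suc i) λ ())) (identityʳ (f zero))
  sum-supported f (suc j) f≈ε = trans (∙-congʳ (f≈ε zero λ ()))
    (trans (identityˡ _) (sum-supported (f ∘ suc) j λ i i≢j → f≈ε (suc i) (i≢j ∘ suc-injective)))

lookup-injective : ∀ {a} {A : Set a} {xs : List A} → Unique xs → ∀ {i j} → lookup xs i ≡ lookup xs j → i ≡ j
lookup-injective (_ ∷ _)      {zero}  {zero}  _     = refl
lookup-injective (x∉xs ∷ _)   {zero}  {suc j} x≡xⱼ  = ⊥-elim (All.lookup x∉xs (∈-lookup j) x≡xⱼ)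
lookup-injective (x∉xs ∷ _)   {suc i} {zero}  xᵢ≡x  = ⊥-elim (All.lookup x∉xs (∈-lookup i) (≡.sym xᵢ≡x))
lookup-injective (_ ∷ unique) {suc i} {suc j} xᵢ≡xⱼ = ≡.cong suc (lookup-injective unique xᵢ≡xⱼ)

module FreeCoordinates {n : ℕ} (Q : FinPoset n) where
  open FinPoset Q
  open IsDecPartialOrder isDPO using () renaming (refl to ≼-refl)

  comparable? : ∀ x y → Dec (Comparable x y)
  comparable? x y = (x ≤? y) ⊎-dec (y ≤? x)

  comparable-refl : ∀ a → Comparable a a
  comparable-refl a = inj₁ ≼-refl

  ↑-idem : ∀ a → a ↑ a ≡ a
  ↑-idem a with a ≤? a
  ... | yes _ = refl
  ... | no _  = refl

  Coord : Set
  Coord = Fin n × Fin n × Fin 2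

  Free : Pred Coord _
  Free (x , y , i) = ¬ Comparable x y ⊎ (x ≡ y × i ≡ zero)

  free? : Decidable Free
  free? (x , y , i) = ¬? (comparable? x y) ⊎-dec ((x ≟ y) ×-dec (i ≟ zero))

  coords : List Coord
  coords = cartesianProduct (allFin n) (cartesianProduct (allFin n) (allFin 2))

  freeCoords : List Coord
  freeCoords = filter free? coords

  dim : ℕ
  dim = length freeCoords

  coord : Fin dim → Coord
  coord = lookup freeCoords

  coord-free : ∀ j → Free (coord j)
  coord-free j = proj₂ (∈-filter⁻ free? {xs = coords} (∈-lookup j))

  coord-injective : ∀ {j j′} → coord j ≡ coord j′ → j ≡ j′
  coord-injective = lookup-injective (Unique.filter⁺ free?
    (Unique.cartesianProduct⁺ (Unique.allFin⁺ n) (Unique.cartesianProduct⁺ (Unique.allFin⁺ n) (Unique.allFin⁺ 2))))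

  coord-surjective : ∀ c → Free c → ∃ λ j → coord j ≡ c
  coord-surjective c@(x , y , i) free = index c∈freeCoords , ≡.sym (lookup-index c∈freeCoords)
    where
    c∈freeCoords : c ∈ freeCoords
    c∈freeCoords = ∈-filter⁺ free?
      (∈-cartesianProduct⁺ (∈-allFin x) (∈-cartesianProduct⁺ (∈-allFin y) (∈-allFin i))) free

module Pairing {k ℓ} (K : Field k ℓ) {n : ℕ} (Q : FinPoset n) where
  open Field K hiding (zero) renaming (refl to ≈-refl; sym to ≈-sym; trans to ≈-trans; reflexive to ≈-reflexive)
  open FieldOps K using (sumFin)
  open Arity3 K Q
  open FinPoset Q using (_↑_)
  open FreeCoordinates Q using (Coord)
  open import Algebra.Properties.Ring ring using (-1*x≈-x; -‿involutive; x[y-z]≈xy-xz)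
  open import Algebra.Properties.Semiring.Sum semiring using (sum; sum-syntax; sum-cong-≋; ∑-distrib-+; *-distribˡ-sum)
  open MonoidSum +-monoid using (sum-zero; sum-supported)
  open import Relation.Binary.Reasoning.Setoid setoid

  _at_ : V → Coord → Carrier
  v at (x , y , i) = v x y i

  δ : Coord → V
  δ (x , y , i) = e x y i

  δ-diag : ∀ c → δ c at c ≈ 1#
  δ-diag (x , y , i) rewrite dec-true (x ≟ x) refl | dec-true (y ≟ y) refl | dec-true (i ≟ i) refl = ≈-refl

  δ-off-diag : ∀ {c c′} → c ≢ c′ → δ c at c′ ≈ 0#
  δ-off-diag {x , y , i} {x′ , y′ , i′} c≢c′ with x ≟ x′ | y ≟ y′ | i ≟ i′
  ... | yes refl | yes refl | yes refl = ⊥-elim (c≢c′ refl)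
  ... | no _     | _        | _        = ≈-refl
  ... | yes _    | no _     | _        = ≈-refl
  ... | yes _    | yes _    | no _     = ≈-refl

  sumFin≡sum : ∀ m (f : Vector Carrier m) → sumFin m f ≡ sum f
  sumFin≡sum zero    f = refl
  sumFin≡sum (suc m) f = ≡.cong (f zero +_) (sumFin≡sum m (f ∘ suc))

  sumFin≈sum : ∀ m {f g : Vector Carrier m} → (∀ i → f i ≈ g i) → sumFin m f ≈ sum g
  sumFin≈sum m {f} f≈g = ≈-trans (≈-reflexive (sumFin≡sum m f)) (sum-cong-≋ f≈g)

  sumFin-cong : ∀ m {f g : Vector Carrier m} → (∀ i → f i ≈ g i) → sumFin m f ≈ sumFin m g
  sumFin-cong m {g = g} f≈g = ≈-trans (sumFin≈sum m f≈g) (≈-reflexive (≡.sym (sumFin≡sum m g)))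

  ∑-sub : ∀ {m} (f g : Vector Carrier m) → ∑[ i < m ] (f i - g i) ≈ sum f - sum g
  ∑-sub f g = begin
    ∑[ i < _ ] (f i - g i)        ≈⟨ ∑-distrib-+ f (λ i → - g i) ⟩
    sum f + ∑[ i < _ ] (- g i)    ≈⟨ +-congˡ (sum-cong-≋ (λ i → -1*x≈-x (g i))) ⟨
    sum f + ∑[ i < _ ] (- 1# * g i) ≈⟨ +-congˡ (*-distribˡ-sum (- 1#) g) ⟨
    sum f + - 1# * sum g          ≈⟨ +-congˡ (-1*x≈-x (sum g)) ⟩
    sum f - sum g                 ∎

  ∑³ : V → Carrier
  ∑³ f = ∑[ x < n ] ∑[ y < n ] ∑[ i < 2 ] f x y i

  ∑³-cong : ∀ {f g} → f ≈V g → ∑³ f ≈ ∑³ g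
  ∑³-cong f≈g = sum-cong-≋ λ x → sum-cong-≋ λ y → sum-cong-≋ λ i → f≈g x y i

  ∑³-sub : ∀ f g → ∑³ (f -V g) ≈ ∑³ f - ∑³ g
  ∑³-sub f g =
    ≈-trans (sum-cong-≋ λ x → ≈-trans (sum-cong-≋ λ y → ∑-sub (f x y) (g x y)) (∑-sub (∑-last f x) (∑-last g x)))
            (∑-sub (λ x → ∑[ y < n ] ∑-last f x y) (λ x → ∑[ y < n ] ∑-last g x y))
    where
    ∑-last : V → Fin n → Fin n → Carrier
    ∑-last h x y = ∑[ i < 2 ] h x y i

  ∑³-supported : ∀ f c → (∀ c′ → c′ ≢ c → f at c′ ≈ 0#) → ∑³ f ≈ f at c
  ∑³-supported f (a , b , k) f≈0 =
    ≈-trans (sum-supported _ a λ x x≢a → sum-zero _ λ y → sum-zero _ λ i → f≈0 (x , y , i) (x≢a ∘ ≡.cong proj₁))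
   (≈-trans (sum-supported _ b λ y y≢b → sum-zero _ λ i → f≈0 (a , y , i) (y≢b ∘ ≡.cong (proj₁ ∘ proj₂)))
          (sum-supported _ k λ i i≢k → f≈0 (a , b , i) (i≢k ∘ ≡.cong (proj₂ ∘ proj₂))))

  ⟨⟩≈∑³ : ∀ u v → ⟨ u , v ⟩ ≈ ∑³ (λ x y i → sgn i * (u x y i * v x y i))
  ⟨⟩≈∑³ u v = sumFin≈sum n λ x → sumFin≈sum n λ y →
    ≈-reflexive (sumFin≡sum 2 λ i → sgn i * (u x y i * v x y i))

  pair-e : ∀ w x y i → ⟨ w , e x y i ⟩ ≈ sgn i * w x y i
  pair-e w x y i = begin
    ⟨ w , e x y i ⟩  ≈⟨ ⟨⟩≈∑³ w (δ c) ⟩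
    ∑³ summand       ≈⟨ ∑³-supported summand c vanishes ⟩
    summand at c     ≈⟨ *-congˡ (≈-trans (*-congˡ (δ-diag c)) (*-identityʳ (w x y i))) ⟩
    sgn i * w x y i  ∎
    where
    c : Coord
    c = x , y , i
    summand : V
    summand x′ y′ i′ = sgn i′ * (w x′ y′ i′ * δ c x′ y′ i′)
    vanishes : ∀ c′ → c′ ≢ c → summand at c′ ≈ 0#
    vanishes c′ c′≢c = ≈-trans (*-congˡ (≈-trans (*-congˡ (δ-off-diag (c′≢c ∘ ≡.sym))) (zeroʳ _))) (zeroʳ _)

  pair-sub : ∀ w u v → ⟨ w , u -V v ⟩ ≈ ⟨ w , u ⟩ - ⟨ w , v ⟩
  pair-sub w u v = begin
    ⟨ w , u -V v ⟩                    ≈⟨ ⟨⟩≈∑³ w (u -V v) ⟩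
    ∑³ (λ x y i → sgn i * (w x y i * (u x y i - v x y i)))
      ≈⟨ ∑³-cong (λ x y i → ≈-trans (*-congˡ (x[y-z]≈xy-xz (w x y i) (u x y i) (v x y i)))
                                          (x[y-z]≈xy-xz (sgn i) (w x y i * u x y i) (w x y i * v x y i))) ⟩
    ∑³ (pairing u -V pairing v)       ≈⟨ ∑³-sub (pairing u) (pairing v) ⟩
    ∑³ (pairing u) - ∑³ (pairing v)   ≈⟨ +-cong (⟨⟩≈∑³ w u) (-‿cong (⟨⟩≈∑³ w v)) ⟨
    ⟨ w , u ⟩ - ⟨ w , v ⟩             ∎
    where
    pairing : V → V
    pairing v x y i = sgn i * (w x y i * v x y i)

  sgn-combine : ∀ a b → sgn zero * a - sgn (suc zero) * b ≈ a + b
  sgn-combine a b = +-cong (*-identityˡ a) (≈-trans (-‿cong (-1*x≈-x b)) (-‿involutive b))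

  pair-rel₁ : ∀ w a b → ⟨ w , rel₁ a b ⟩ ≈ w a b zero + w (a ↑ b) (a ↑ b) (suc zero)
  pair-rel₁ w a b = ≈-trans (pair-sub w (e a b zero) (e m m (suc zero)))
    (≈-trans (+-cong (pair-e w a b zero) (-‿cong (pair-e w m m (suc zero)))) (sgn-combine _ _))
    where m = a ↑ b

  pair-rel₂ : ∀ w a b → ⟨ w , rel₂ a b ⟩ ≈ w (a ↑ b) (a ↑ b) zero + w a b (suc zero)
  pair-rel₂ w a b = ≈-trans (pair-sub w (e m m zero) (e a b (suc zero)))
    (≈-trans (+-cong (pair-e w m m zero) (-‿cong (pair-e w a b (suc zero)))) (sgn-combine _ _))
    where m = a ↑ b

module Annihilator {k ℓ} (K : Field k ℓ) {n : ℕ} (Q : FinPoset n) where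
  open Field K hiding (zero) renaming (refl to ≈-refl; sym to ≈-sym; trans to ≈-trans; reflexive to ≈-reflexive)
  open FieldOps K using (sumFin)
  open Arity3 K Q
  open FinPoset Q using (Comparable; _↑_)
  open FreeCoordinates Q
  open Pairing K Q
  open import Algebra.Properties.Ring ring using (-1*x≈-x; +-inverseˡ-unique; +-inverseʳ-unique)
  open import Algebra.Properties.CommutativeSemigroup *-commutativeSemigroup using (x∙yz≈y∙xz)
  open import Algebra.Properties.Semiring.Sum semiring using (sum-syntax; *-distribˡ-sum)
  open MonoidSum +-monoid using (sum-supported)
  open import Relation.Binary.Reasoning.Setoid setoid

  ext : V → V
  ext u x y i with comparable? x y
  ... | yes _ = sgn i * u (x ↑ y) (x ↑ y) zero
  ... | no _  = u x y i

  ext-comparable : ∀ u {x y} i → Comparable x y → ext u x y i ≡ sgn i * u (x ↑ y) (x ↑ y) zero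
  ext-comparable u {x} {y} i xy with comparable? x y
  ... | yes _  = refl
  ... | no ¬xy = ⊥-elim (¬xy xy)

  ext-incomparable : ∀ u {x y} i → ¬ Comparable x y → ext u x y i ≡ u x y i
  ext-incomparable u {x} {y} i ¬xy with comparable? x y
  ... | yes xy = ⊥-elim (¬xy xy)
  ... | no _   = refl

  ext-diag : ∀ u a i → ext u a a i ≡ sgn i * u a a zero
  ext-diag u a i = ≡.trans (ext-comparable u i (comparable-refl a)) (≡.cong (λ m → sgn i * u m m zero) (↑-idem a))

  ext-annihilated : ∀ u → InAnnihilator (ext u)
  ext-annihilated u a b ab = annihilates-rel₁ , annihilates-rel₂
    where
    m = a ↑ b
    cancel : ∀ t → sgn zero * t + sgn (suc zero) * t ≈ 0#
    cancel t = ≈-trans (+-cong (*-identityˡ t) (-1*x≈-x t)) (-‿inverseʳ t)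
    annihilates-rel₁ : ⟨ ext u , rel₁ a b ⟩ ≈ 0#
    annihilates-rel₁ = begin
      ⟨ ext u , rel₁ a b ⟩                                 ≈⟨ pair-rel₁ (ext u) a b ⟩
      ext u a b zero + ext u m m (suc zero)                ≡⟨ ≡.cong₂ _+_ (ext-comparable u zero ab) (ext-diag u m (suc zero)) ⟩
      sgn zero * u m m zero + sgn (suc zero) * u m m zero  ≈⟨ cancel (u m m zero) ⟩
      0#                                                   ∎
    annihilates-rel₂ : ⟨ ext u , rel₂ a b ⟩ ≈ 0#
    annihilates-rel₂ = begin
      ⟨ ext u , rel₂ a b ⟩                                 ≈⟨ pair-rel₂ (ext u) a b ⟩
      ext u m m zero + ext u a b (suc zero)                ≡⟨ ≡.cong₂ _+_ (ext-diag u m zero) (ext-comparable u (suc zero) ab) ⟩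
      sgn zero * u m m zero + sgn (suc zero) * u m m zero  ≈⟨ cancel (u m m zero) ⟩
      0#                                                   ∎

  annihilated-fixed : ∀ w → InAnnihilator w → w ≈V ext w
  annihilated-fixed w ann x y i with comparable? x y
  ... | no _   = ≈-refl
  ... | yes xy = fixed i
    where
    m = x ↑ y
    rel₁-xy : w x y zero + w m m (suc zero) ≈ 0#
    rel₁-xy = ≈-trans (≈-sym (pair-rel₁ w x y)) (proj₁ (ann x y xy))
    rel₂-xy : w m m zero + w x y (suc zero) ≈ 0#
    rel₂-xy = ≈-trans (≈-sym (pair-rel₂ w x y)) (proj₂ (ann x y xy))
    rel₁-mm : w m m zero + w m m (suc zero) ≈ 0#
    rel₁-mm = ≡.subst (λ m′ → w m m zero + w m′ m′ (suc zero) ≈ 0#) (↑-idem m)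
                (≈-trans (≈-sym (pair-rel₁ w m m)) (proj₁ (ann m m (comparable-refl m))))
    fixed : ∀ i → w x y i ≈ sgn i * w m m zero
    fixed zero = begin
      w x y zero             ≈⟨ +-inverseˡ-unique _ _ rel₁-xy ⟩
      - w m m (suc zero)     ≈⟨ +-inverseˡ-unique _ _ rel₁-mm ⟨
      w m m zero             ≈⟨ *-identityˡ _ ⟨
      1# * w m m zero        ∎
    fixed (suc zero) = ≈-trans (+-inverseʳ-unique _ _ rel₂-xy) (≈-sym (-1*x≈-x _))

  ext-free : ∀ u c → Free c → ext u at c ≈ u at c
  ext-free u (x , y , i)      (inj₁ ¬xy)        = ≈-reflexive (ext-incomparable u i ¬xy)
  ext-free u (x , .x , .zero) (inj₂ (refl , refl)) = ≈-trans (≈-reflexive (ext-diag u x zero)) (*-identityˡ _)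

  ext-cong-free : ∀ {u v} → (∀ c → Free c → u at c ≈ v at c) → ext u ≈V ext v
  ext-cong-free {u} {v} u≈v x y i with comparable? x y
  ... | yes _  = *-congˡ (u≈v (x ↑ y , x ↑ y , zero) (inj₂ (refl , refl)))
  ... | no ¬xy = u≈v (x , y , i) (inj₁ ¬xy)

  ext-lincomb : ∀ d coef (b : Fin d → V) → ext (lincomb d coef b) ≈V lincomb d coef (ext ∘ b)
  ext-lincomb d coef b x y i with comparable? x y
  ... | no _  = ≈-refl
  ... | yes _ = begin
    sgn i * sumFin d (λ j → coef j * b j m m zero)    ≈⟨ *-congˡ (≈-reflexive (sumFin≡sum d _)) ⟩
    sgn i * ∑[ j < d ] (coef j * b j m m zero)        ≈⟨ *-distribˡ-sum (sgn i) (λ j → coef j * b j m m zero) ⟩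
    ∑[ j < d ] (sgn i * (coef j * b j m m zero))      ≈⟨ sumFin≈sum d (λ j → x∙yz≈y∙xz (coef j) (sgn i) _) ⟨
    sumFin d (λ j → coef j * (sgn i * b j m m zero))  ∎
    where m = x ↑ y

  ≈V-at : ∀ {u v} → u ≈V v → ∀ c → u at c ≈ v at c
  ≈V-at u≈v (x , y , i) = u≈v x y i

  lincomb-δ-at-coord : ∀ coef j → lincomb dim coef (δ ∘ coord) at coord j ≈ coef j
  lincomb-δ-at-coord coef j = begin
    lincomb dim coef (δ ∘ coord) at coord j      ≈⟨ ≈-reflexive (sumFin≡sum dim _) ⟩
    ∑[ j′ < dim ] (coef j′ * δ (coord j′) at coord j) ≈⟨ sum-supported _ j vanishes ⟩
    coef j * δ (coord j) at coord j             ≈⟨ *-congˡ (δ-diag (coord j)) ⟩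
    coef j * 1#                                  ≈⟨ *-identityʳ (coef j) ⟩
    coef j                                       ∎
    where
    vanishes : ∀ j′ → j′ ≢ j → coef j′ * δ (coord j′) at coord j ≈ 0#
    vanishes j′ j′≢j = ≈-trans (*-congˡ (δ-off-diag (j′≢j ∘ coord-injective))) (zeroʳ (coef j′))

  basis : Fin dim → V
  basis j = ext (δ (coord j))

  lincomb-basis-at-coord : ∀ coef j → lincomb dim coef basis at coord j ≈ coef j
  lincomb-basis-at-coord coef j = ≈-trans
    (sumFin-cong dim λ j′ → *-congˡ (ext-free (δ (coord j′)) (coord j) (coord-free j)))
    (lincomb-δ-at-coord coef j)

  basis-independent : ∀ coef → lincomb dim coef basis ≈V 0V → ∀ j → coef j ≈ 0#
  basis-independent coef ∑≈0 j = ≈-trans (≈-sym (lincomb-basis-at-coord coef j)) (≈V-at ∑≈0 (coord j))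

  basis-spans : ∀ w → InAnnihilator w → Σ (Fin dim → Carrier) λ coef → w ≈V lincomb dim coef basis
  basis-spans w ann = coef , λ x y i → ≈-trans (annihilated-fixed w ann x y i)
                                      (≈-trans (ext-cong-free agree x y i) (ext-lincomb dim coef (δ ∘ coord) x y i))
    where
    coef : Fin dim → Carrier
    coef j = w at coord j
    agree : ∀ c → Free c → w at c ≈ lincomb dim coef (δ ∘ coord) at c
    agree c free with coord-surjective c free
    ... | j , refl = ≈-sym (lincomb-δ-at-coord coef j)

  annihilator-dim : HasDim InAnnihilator dim
  annihilator-dim = basis , (λ j → ext-annihilated (δ (coord j))) , basis-independent , basis-spans

open import Data.Nat using (_+_; _*_; _^_)
open import Data.Nat.Properties using (+-*-semiring; +-0-monoid)
open import Data.Nat.ListAction using () renaming (sum to sumᴸ)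
open import Data.Nat.ListAction.Properties using (sum-++)
open import Data.Nat.Tactic.RingSolver using (solve-∀)

𝟙 : ∀ {p} {P : Set p} → Dec P → ℕ
𝟙 (yes _) = 1
𝟙 (no _)  = 0

length-filter : ∀ {a p} {A : Set a} {P : Pred A p} (P? : Decidable P) xs →
  length (filter P? xs) ≡ sumᴸ (map (𝟙 ∘ P?) xs)
length-filter P? []       = refl
length-filter P? (x ∷ xs) with P? x
... | yes _ = ≡.cong suc (length-filter P? xs)
... | no _  = length-filter P? xs

sum-map-cartesianProduct : ∀ {a b} {A : Set a} {B : Set b} (f : A × B → ℕ) xs ys →
  sumᴸ (map f (cartesianProduct xs ys)) ≡ sumᴸ (map (λ x → sumᴸ (map (f ∘ (x ,_)) ys)) xs)
sum-map-cartesianProduct f []       ys = refl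
sum-map-cartesianProduct f (x ∷ xs) ys = begin
  sumᴸ (map f (map (x ,_) ys ++ cartesianProduct xs ys))
    ≡⟨ ≡.cong sumᴸ (map-++ f (map (x ,_) ys) _) ⟩
  sumᴸ (map f (map (x ,_) ys) ++ map f (cartesianProduct xs ys))
    ≡⟨ sum-++ (map f (map (x ,_) ys)) _ ⟩
  sumᴸ (map f (map (x ,_) ys)) + sumᴸ (map f (cartesianProduct xs ys))
    ≡⟨ ≡.cong₂ _+_ (≡.cong sumᴸ (≡.sym (map-∘ ys))) (sum-map-cartesianProduct f xs ys) ⟩
  sumᴸ (map (f ∘ (x ,_)) ys) + sumᴸ (map (λ x → sumᴸ (map (f ∘ (x ,_)) ys)) xs) ∎
  where open ≡-Reasoning

module NatSum where
  open import Algebra.Properties.Semiring.Sum +-*-semiring public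
    using (sum; sum-syntax; sum-cong-≗; ∑-distrib-+; ∑-comm; *-distribˡ-sum)
  open MonoidSum +-0-monoid using (sum-supported)

  sum-map-tabulate : ∀ {a} {A : Set a} m (f : A → ℕ) (g : Fin m → A) →
    sumᴸ (map f (tabulate g)) ≡ ∑[ i < m ] f (g i)
  sum-map-tabulate zero    f g = refl
  sum-map-tabulate (suc m) f g = ≡.cong (f (g zero) +_) (sum-map-tabulate m f (g ∘ suc))

  sum-map-allFin : ∀ m (f : Fin m → ℕ) → sumᴸ (map f (allFin m)) ≡ ∑[ i < m ] f i
  sum-map-allFin m f = sum-map-tabulate m f id

  sum-map-cartesianProduct-allFin : ∀ {b} {B : Set b} m ys (f : Fin m × B → ℕ) →
    sumᴸ (map f (cartesianProduct (allFin m) ys)) ≡ ∑[ x < m ] sumᴸ (map (f ∘ (x ,_)) ys)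
  sum-map-cartesianProduct-allFin m ys f =
    ≡.trans (sum-map-cartesianProduct f (allFin m) ys) (sum-map-allFin m (λ x → sumᴸ (map (f ∘ (x ,_)) ys)))

  ∑-const : ∀ m c → ∑[ i < m ] c ≡ m * c
  ∑-const zero    c = refl
  ∑-const (suc m) c = ≡.cong (c +_) (∑-const m c)

  ∑-linear : ∀ {m} k (f g h : Vector ℕ m) →
    ∑[ i < m ] (f i + k * (g i + h i)) ≡ sum f + k * (sum g + sum h)
  ∑-linear k f g h = begin
    ∑[ i < _ ] (f i + k * (g i + h i))    ≡⟨ ∑-distrib-+ f _ ⟩
    sum f + ∑[ i < _ ] (k * (g i + h i))  ≡⟨ ≡.cong (sum f +_) (*-distribˡ-sum k (λ i → g i + h i)) ⟨
    sum f + k * ∑[ i < _ ] (g i + h i)    ≡⟨ ≡.cong (λ s → sum f + k * s) (∑-distrib-+ g h) ⟩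
    sum f + k * (sum g + sum h)           ∎
    where open ≡-Reasoning

  ∑-𝟙≟ : ∀ {m} (x : Fin m) → ∑[ y < m ] 𝟙 (x ≟ y) ≡ 1
  ∑-𝟙≟ x = ≡.trans (sum-supported _ x 𝟙≟≡0) (𝟙≟-refl x)
    where
    𝟙≟≡0 : ∀ y → y ≢ x → 𝟙 (x ≟ y) ≡ 0
    𝟙≟≡0 y y≢x with x ≟ y
    ... | yes x≡y = ⊥-elim (y≢x (≡.sym x≡y))
    ... | no _    = refl
    𝟙≟-refl : ∀ x → 𝟙 (x ≟ x) ≡ 1
    𝟙≟-refl x with x ≟ x
    ... | yes _  = refl
    ... | no x≢x = ⊥-elim (x≢x refl)

module DimensionCount {n : ℕ} (Q : FinPoset n) where
  open FinPoset Q
  open IsDecPartialOrder isDPO using (antisym) renaming (refl to ≼-refl)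
  open FreeCoordinates Q
  open NatSum

  -- Summed over all pairs (x, y), the left-hand side is dim + 4 int and the right-hand side 2n² + 3n.
  free-count : ∀ x y →
    ∑[ i < 2 ] 𝟙 (free? (x , y , i)) + 2 * (𝟙 (x ≤? y) + 𝟙 (y ≤? x)) ≡ 2 + 3 * 𝟙 (x ≟ y)
  free-count x y with x ≤? y | y ≤? x | x ≟ y
  ... | yes _   | yes _   | yes _    = refl
  ... | yes x≼y | yes y≼x | no x≢y   = ⊥-elim (x≢y (antisym x≼y y≼x))
  ... | yes _   | no _    | no _     = refl
  ... | no _    | yes _   | no _     = refl
  ... | no _    | no _    | no _     = refl
  ... | _       | no y⋠x  | yes refl = ⊥-elim (y⋠x ≼-refl)
  ... | no x⋠y  | _       | yes refl = ⊥-elim (x⋠y ≼-refl)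

  dim≡∑ : dim ≡ ∑[ x < n ] ∑[ y < n ] ∑[ i < 2 ] 𝟙 (free? (x , y , i))
  dim≡∑ = begin
    dim                                                               ≡⟨ length-filter free? coords ⟩
    sumᴸ (map (𝟙 ∘ free?) coords)                                     ≡⟨ sum-map-cartesianProduct-allFin n _ _ ⟩
    ∑[ x < n ] sumᴸ (map (𝟙 ∘ free? ∘ (x ,_)) (cartesianProduct (allFin n) (allFin 2)))
      ≡⟨ sum-cong-≗ (λ x → sum-map-cartesianProduct-allFin n (allFin 2) (𝟙 ∘ free? ∘ (x ,_))) ⟩
    ∑[ x < n ] ∑[ y < n ] sumᴸ (map (λ i → 𝟙 (free? (x , y , i))) (allFin 2))
      ≡⟨ sum-cong-≗ (λ x → sum-cong-≗ (λ y → sum-map-allFin 2 (λ i → 𝟙 (free? (x , y , i))))) ⟩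
    ∑[ x < n ] ∑[ y < n ] ∑[ i < 2 ] 𝟙 (free? (x , y , i))            ∎
    where open ≡-Reasoning

  int≡∑ : int ≡ ∑[ x < n ] ∑[ y < n ] 𝟙 (x ≤? y)
  int≡∑ = begin
    int                                                    ≡⟨ length-filter _ (cartesianProduct (allFin n) (allFin n)) ⟩
    sumᴸ (map _ (cartesianProduct (allFin n) (allFin n)))  ≡⟨ sum-map-cartesianProduct-allFin n (allFin n) _ ⟩
    ∑[ x < n ] sumᴸ (map (λ y → 𝟙 (x ≤? y)) (allFin n))
      ≡⟨ sum-cong-≗ (λ x → sum-map-allFin n (λ y → 𝟙 (x ≤? y))) ⟩
    ∑[ x < n ] ∑[ y < n ] 𝟙 (x ≤? y)                       ∎
    where open ≡-Reasoning

  ∑-diagonal : ∀ x → ∑[ y < n ] (2 + 3 * 𝟙 (x ≟ y)) ≡ n * 2 + 3 * 1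
  ∑-diagonal x = begin
    ∑[ y < n ] (2 + 3 * 𝟙 (x ≟ y))           ≡⟨ ∑-distrib-+ (λ _ → 2) (λ y → 3 * 𝟙 (x ≟ y)) ⟩
    ∑[ y < n ] 2 + ∑[ y < n ] (3 * 𝟙 (x ≟ y))
      ≡⟨ ≡.cong₂ _+_ (∑-const n 2) (≡.sym (*-distribˡ-sum 3 (λ y → 𝟙 (x ≟ y)))) ⟩
    n * 2 + 3 * ∑[ y < n ] 𝟙 (x ≟ y)         ≡⟨ ≡.cong (λ s → n * 2 + 3 * s) (∑-𝟙≟ x) ⟩
    n * 2 + 3 * 1                             ∎
    where open ≡-Reasoning

  ∑∑ : (Fin n → Fin n → ℕ) → ℕ
  ∑∑ f = ∑[ x < n ] ∑[ y < n ] f x y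

  ∑∑-linear : ∀ k (f g h : Fin n → Fin n → ℕ) →
    ∑∑ (λ x y → f x y + k * (g x y + h x y)) ≡ ∑∑ f + k * (∑∑ g + ∑∑ h)
  ∑∑-linear k f g h = ≡.trans (sum-cong-≗ λ x → ∑-linear k (f x) (g x) (h x))
    (∑-linear k (λ x → ∑[ y < n ] f x y) (λ x → ∑[ y < n ] g x y) (λ x → ∑[ y < n ] h x y))

  int≡∑ᵀ : int ≡ ∑∑ (λ x y → 𝟙 (y ≤? x))
  int≡∑ᵀ = ≡.trans int≡∑ (∑-comm (λ y x → 𝟙 (y ≤? x)))

  dim-formula : dim + 4 * int ≡ 2 * n ^ 2 + 3 * n
  dim-formula = begin
    dim + 4 * int                                                    ≡⟨ 4*≡2*[+] dim int ⟩
    dim + 2 * (int + int)                                            ≡⟨ ≡.cong₂ (λ s t → s + 2 * t) dim≡∑ (≡.cong₂ _+_ int≡∑ int≡∑ᵀ) ⟩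
    ∑∑ free₂ + 2 * (∑∑ (λ x y → 𝟙 (x ≤? y)) + ∑∑ (λ x y → 𝟙 (y ≤? x))) ≡⟨ ∑∑-linear 2 free₂ _ _ ⟨
    ∑∑ (λ x y → free₂ x y + 2 * (𝟙 (x ≤? y) + 𝟙 (y ≤? x)))           ≡⟨ sum-cong-≗ (λ x → sum-cong-≗ (free-count x)) ⟩
    ∑∑ (λ x y → 2 + 3 * 𝟙 (x ≟ y))                                   ≡⟨ sum-cong-≗ ∑-diagonal ⟩
    ∑[ x < n ] (n * 2 + 3 * 1)                                       ≡⟨ ∑-const n _ ⟩
    n * (n * 2 + 3 * 1)                                              ≡⟨ expand n ⟩
    2 * n ^ 2 + 3 * n                                                ∎
    where
    open ≡-Reasoning
    free₂ : Fin n → Fin n → ℕ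
    free₂ x y = ∑[ i < 2 ] 𝟙 (free? (x , y , i))
    4*≡2*[+] : ∀ d k → d + 4 * k ≡ d + 2 * (k + k)
    4*≡2*[+] = solve-∀
    expand : ∀ n → n * (n * 2 + 3 * 1) ≡ 2 * (n * (n * 1)) + 3 * n
    expand = solve-∀

proposition3p12 : ∀ {c ℓ} (K : Field c ℓ) → CharZero K →
    (n : ℕ) (Q : FinPoset n) →
    Σ ℕ λ d → Arity3.HasDim K Q (Arity3.InAnnihilator K Q) d
    × (d + 4 * FinPoset.int Q ≡ 2 * n ^ 2 + 3 * n)
proposition3p12 K _ n Q = FreeCoordinates.dim Q , Annihilator.annihilator-dim K Q , DimensionCount.dim-formula Q
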